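{- Let $\{P_n\}_{n\ge 0}$ be the Pell sequence, defined by $P_0=0$, $P_1=1$ and $P_{n+2}=2P_{n+1}+P_n$, and let $\alpha=1+\sqrt{2}$. For a prime $p$, let $z(p)$ be the smallest positive integer $k$ such that $p\mid P_k$, and let $e_p$ be the exponent of $p$ in the prime factorization of $P_{z(p)}$ (so $P_{z(p)}=p^{e_p}m_p$ with $p\nmid m_p$). Then for every prime $p$, $$e_p\le \frac{(p+1)\log\alpha}{2\log p}.$$ -}

module Defs where

open import Data.Nat using (ℕ; zero; suc; _+_; _*_; _∸_; _^_; _≤_; _<_)
open import Data.Nat.Divisibility using (_∣_)
open import Data.Product using (_×_; _,_; proj₁; proj₂)
open import Relation.Nullary using (¬_)

P : ℕ → ℕ
P zero = 0
P (suc zero) = 1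
P (suc (suc n)) = 2 * P (suc n) + P n

IsRankOfApparition : ℕ → ℕ → Set
IsRankOfApparition p z = 0 < z × p ∣ P z × (∀ k → 0 < k → k < z → ¬ (p ∣ P k))

IsExactExponent : ℕ → ℕ → ℕ → Set
IsExactExponent p e m = (p ^ e) ∣ m × ¬ ((p ^ suc e) ∣ m)

-- α^n = a + b √2 with α = 1 + √2, represented exactly as the pair (a , b)
alphaPow : ℕ → ℕ × ℕ
alphaPow zero = 1 , 0
alphaPow (suc n) = let a = proj₁ (alphaPow n) ; b = proj₂ (alphaPow n)
                   in a + 2 * b , a + b

-- x ≤ α^n as real numbers, decided exactly: with α^n = a + b√2 (a,b ≥ 0),
-- x ≤ a + b√2  ⇔  (x ∸ a)² ≤ 2 b²
_≤α^_ : ℕ → ℕ → Set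
x ≤α^ n = let a = proj₁ (alphaPow n) ; b = proj₂ (alphaPow n)
          in (x ∸ a) * (x ∸ a) ≤ 2 * (b * b)

module Submission where

-- Write α^n = A n + B n √2 with α = 1 + √2, so that B is the Pell sequence P.
-- The paper's inequality e ≤ (p + 1) log α / (2 log p) says p^(2e) ≤ α^(p+1);
-- we prove the stronger p^(2e) ≤ A (p + 1), using only p^e ∣ P z.
--
-- 1. Arithmetic of α^n: B = P, the addition formula, coprimality of A n and
--    B n, growth of A, and the norm equation A(2k)² = 1 + 2 B(2k)².
-- 2. The rank of apparition z of p divides every N with p ∣ P N.
-- 3. For an odd prime p, A p ≡ 1 (mod p) by the binomial theorem for (1 + √2)^p,
--    and the Cassini identity A p² = 1 + 2 P(p-1) P(p+1) then shows that p
--    divides P (p - 1) or P (p + 1); so z divides an even 2t ≤ p + 1.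
-- 4. Core estimate: if z = 2k then p^e ∣ A k and p^(2e) ≤ A k² ≤ A (2k);
--    if z is odd then 2z ≤ p + 1 and p^(2e) ≤ B z² ≤ A (2z).  Both are at most
--    A (p + 1) by monotonicity.  The prime 2 is checked directly.

open import Defs
open import Data.Nat using (ℕ; zero; suc; _+_; _*_; _^_; _≤_; _<_; z≤n; s≤s; >-nonZero; nonTrivial⇒≢1)
open import Data.Nat using (_≤′_; ≤′-refl; ≤′-step)
open import Data.Nat.Properties
open import Data.Nat.Divisibility
open import Data.Nat.DivMod using (_%_; _/_; m≡m%n+[m/n]*n; m%n<n)
open import Data.Nat.Primality using (Prime; euclidsLemma; prime⇒irreducible)
open import Data.Nat.Primality using (prime⇒nonTrivial; prime⇒nonZero)
open import Data.Nat.Coprimality using (Coprime)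
open import Data.Nat.Combinatorics using (_C_; nCk+nC[k+1]≡[n+1]C[k+1]; nCn≡1; nC1≡n; k>n⇒nCk≡0)
open import Data.Nat.Tactic.RingSolver using (solve-∀)
open import Data.Product using (_×_; _,_; proj₁; proj₂; ∃)
open import Data.Sum using (_⊎_; inj₁; inj₂)
open import Data.Empty using (⊥; ⊥-elim)
open import Relation.Nullary using (¬_)
open import Relation.Binary.PropositionalEquality

A : ℕ → ℕ
A n = proj₁ (alphaPow n)

B : ℕ → ℕ
B n = proj₂ (alphaPow n)

B-step : ∀ n → B (suc (suc n)) ≡ 2 * B (suc n) + B n
B-step n = identity (A n) (B n)
  where
  identity : ∀ a b → (a + 2 * b) + (a + b) ≡ 2 * (a + b) + b
  identity = solve-∀

B≡P : ∀ n → B n ≡ P n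
B≡P zero = refl
B≡P (suc zero) = refl
B≡P (suc (suc n)) = trans (B-step n) (cong₂ (λ x y → 2 * x + y) (B≡P (suc n)) (B≡P n))

α-add : ∀ m n → A (m + n) ≡ A m * A n + 2 * (B m * B n)
              × B (m + n) ≡ A m * B n + B m * A n
α-add zero n = base-A (A n) (B n) , base-B (A n) (B n)
  where
  base-A : ∀ a b → a ≡ 1 * a + 2 * (0 * b)
  base-A = solve-∀
  base-B : ∀ a b → b ≡ 1 * b + 0 * a
  base-B = solve-∀
α-add (suc m) n with α-add m n
... | IH-A , IH-B = trans (cong₂ (λ x y → x + 2 * y) IH-A IH-B) (step-A (A m) (B m) (A n) (B n))
                  , trans (cong₂ _+_ IH-A IH-B) (step-B (A m) (B m) (A n) (B n))
  where
  step-A : ∀ a b c d → (a * c + 2 * (b * d)) + 2 * (a * d + b * c) ≡ (a + 2 * b) * c + 2 * ((a + b) * d)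
  step-A = solve-∀
  step-B : ∀ a b c d → (a * c + 2 * (b * d)) + (a * d + b * c) ≡ (a + 2 * b) * d + (a + b) * c
  step-B = solve-∀

A-add : ∀ m n → A (m + n) ≡ A m * A n + 2 * (B m * B n)
A-add m n = proj₁ (α-add m n)

B-add : ∀ m n → B (m + n) ≡ A m * B n + B m * A n
B-add m n = proj₂ (α-add m n)

A-pos : ∀ n → 0 < A n
A-pos zero = s≤s z≤n
A-pos (suc n) = ≤-trans (A-pos n) (m≤m+n (A n) (2 * B n))

B-pos : ∀ n → 0 < B (suc n)
B-pos n = ≤-trans (A-pos n) (m≤m+n (A n) (B n))

A-mono : ∀ {m n} → m ≤ n → A m ≤ A n
A-mono le = mono′ (≤⇒≤′ le)
  where
  mono′ : ∀ {m n} → m ≤′ n → A m ≤ A n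
  mono′ ≤′-refl = ≤-refl
  mono′ (≤′-step {n} le) = ≤-trans (mono′ le) (m≤m+n (A n) (2 * B n))

-- By the addition formula A (2k) = A k ² + 2 B k ², which dominates both squares.
A²≤A-double : ∀ k → A k * A k ≤ A (k + k)
A²≤A-double k = subst (A k * A k ≤_) (sym (A-add k k)) (m≤m+n _ _)

B²≤A-double : ∀ k → B k * B k ≤ A (k + k)
B²≤A-double k = subst (B k * B k ≤_) (sym (A-add k k))
  (≤-trans (m≤n*m (B k * B k) 2) (m≤n+m (2 * (B k * B k)) (A k * A k)))

-- A n and B n have no common divisor but 1: a common divisor of
-- A (n+1) = (A n + B n) + B n and B (n+1) = A n + B n divides B n and A n.
A-B-coprime : ∀ n → Coprime (A n) (B n)
A-B-coprime n (dA , dB) = ∣1⇒≡1 (common-divisor n dA dB)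
  where
  common-divisor : ∀ {d} n → d ∣ A n → d ∣ B n → d ∣ 1
  common-divisor zero dA _ = dA
  common-divisor {d} (suc n) dA dB = common-divisor n
    (∣m+n∣m⇒∣n (subst (d ∣_) (+-comm (A n) (B n)) dB) dBn) dBn
    where
    regroup : ∀ a b → a + 2 * b ≡ (a + b) + b
    regroup = solve-∀
    dBn : d ∣ B n
    dBn = ∣m+n∣m⇒∣n (subst (d ∣_) (regroup (A n) (B n)) dA) dB

prime-∤-both : ∀ {p} n → Prime p → p ∣ A n → p ∣ B n → ⊥
prime-∤-both n pp dA dB = nonTrivial⇒≢1 {{prime⇒nonTrivial pp}} (A-B-coprime n (dA , dB))

B-multiple : ∀ {d n} q → d ∣ B n → d ∣ B (q * n)
B-multiple zero _ = _ ∣0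
B-multiple {n = n} (suc q) dB = subst (_ ∣_) (sym (B-add n (q * n)))
  (∣m∣n⇒∣m+n (∣n⇒∣m*n (A n) (B-multiple q dB)) (∣m⇒∣m*n (A (q * n)) dB))

-- The rank of apparition z of p divides every index N with p ∣ P N:
-- write N = r + q z with r < z; then p ∣ B r · A (q z) and p ∤ A (q z),
-- so p ∣ B r, which forces r = 0 by minimality of z.
rank-divides : ∀ {p z} N → Prime p → IsRankOfApparition p z → p ∣ P N → z ∣ N
rank-divides {p} {z} N pp (z>0 , p∣Pz , minimal) p∣PN = m%n≡0⇒n∣m N z r≡0
  where
  instance _ = >-nonZero z>0
  q r : ℕ
  q = N / z
  r = N % z
  p∣Bqz : p ∣ B (q * z)
  p∣Bqz = B-multiple q (subst (p ∣_) (sym (B≡P z)) p∣Pz)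
  split : B N ≡ A r * B (q * z) + B r * A (q * z)
  split = trans (cong B (m≡m%n+[m/n]*n N z)) (B-add r (q * z))
  p∣Br : p ∣ B r
  p∣Br with euclidsLemma (B r) (A (q * z)) pp
    (∣m+n∣m⇒∣n (subst (p ∣_) (trans (sym (B≡P N)) split) p∣PN) (∣n⇒∣m*n (A r) p∣Bqz))
  ... | inj₁ d = d
  ... | inj₂ d = ⊥-elim (prime-∤-both (q * z) pp d p∣Bqz)
  r≡0 : r ≡ 0
  r≡0 with r | m%n<n N z | p∣Br
  ... | zero | _ | _ = refl
  ... | suc r′ | r<z | d = ⊥-elim (minimal (suc r′) (s≤s z≤n) r<z (subst (p ∣_) (B≡P (suc r′)) d))

-- Norm equation at even indices: A (2k)² = 1 + 2 B (2k)².  It holds at 0, and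
-- α² = 3 + 2√2 has norm 1, so the norm of α^(n+2) equals that of α^n.
norm-step : ∀ n → A n * A n ≡ 1 + 2 * (B n * B n)
          → A (suc (suc n)) * A (suc (suc n)) ≡ 1 + 2 * (B (suc (suc n)) * B (suc (suc n)))
norm-step n norm = +-cancelʳ-≡ (2 * (b * b)) _ _ (begin
    X * X + 2 * (b * b)                ≡⟨ invariance a b ⟩
    a * a + 2 * (Y * Y)                ≡⟨ cong (_+ 2 * (Y * Y)) norm ⟩
    (1 + 2 * (b * b)) + 2 * (Y * Y)    ≡⟨ swap (b * b) (Y * Y) ⟩
    (1 + 2 * (Y * Y)) + 2 * (b * b)    ∎)
  where
  open ≡-Reasoning
  a b X Y : ℕ
  a = A n
  b = B n
  X = A (suc (suc n))
  Y = B (suc (suc n))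
  invariance : ∀ a b → let X = (a + 2 * b) + 2 * (a + b) ; Y = (a + 2 * b) + (a + b)
                       in X * X + 2 * (b * b) ≡ a * a + 2 * (Y * Y)
  invariance = solve-∀
  swap : ∀ u v → (1 + 2 * u) + 2 * v ≡ (1 + 2 * v) + 2 * u
  swap = solve-∀

norm-even : ∀ k → A (k + k) * A (k + k) ≡ 1 + 2 * (B (k + k) * B (k + k))
norm-even zero = refl
norm-even (suc k) rewrite +-suc k k = norm-step (k + k) (norm-even k)

-- A Cassini-type identity at odd indices n = 2m+1:
-- A n² = 1 + 2 B (n-1) B (n+1), a consequence of the norm equation at n - 1.
cassini-odd : ∀ m → let n = m + m in
              A (suc n) * A (suc n) ≡ 1 + 2 * (B n * B (suc (suc n)))
cassini-odd m = begin
    (a + 2 * b) * (a + 2 * b)              ≡⟨ expand a b ⟩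
    a * a + 4 * (a * b + b * b)            ≡⟨ cong (_+ 4 * (a * b + b * b)) (norm-even m) ⟩
    1 + 2 * (b * b) + 4 * (a * b + b * b)  ≡⟨ collect a b ⟩
    1 + 2 * (b * ((a + 2 * b) + (a + b)))  ∎
  where
  open ≡-Reasoning
  a b : ℕ
  a = A (m + m)
  b = B (m + m)
  expand : ∀ a b → (a + 2 * b) * (a + 2 * b) ≡ a * a + 4 * (a * b + b * b)
  expand = solve-∀
  collect : ∀ a b → 1 + 2 * (b * b) + 4 * (a * b + b * b) ≡ 1 + 2 * (b * ((a + 2 * b) + (a + b)))
  collect = solve-∀

∑< : ℕ → (ℕ → ℕ) → ℕ
∑< zero f = 0
∑< (suc n) f = f 0 + ∑< n (λ k → f (suc k))

∑<-cong : ∀ n {f g} → (∀ k → f k ≡ g k) → ∑< n f ≡ ∑< n g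
∑<-cong zero f≡g = refl
∑<-cong (suc n) f≡g = cong₂ _+_ (f≡g 0) (∑<-cong n (λ k → f≡g (suc k)))

∑<-last : ∀ n f → ∑< (suc n) f ≡ ∑< n f + f n
∑<-last zero f = +-comm (f 0) 0
∑<-last (suc n) f = trans (cong (f 0 +_) (∑<-last n (λ k → f (suc k)))) (sym (+-assoc (f 0) _ _))

∑<-+ : ∀ n f g → ∑< n (λ k → f k + g k) ≡ ∑< n f + ∑< n g
∑<-+ zero f g = refl
∑<-+ (suc n) f g = trans (cong (f 0 + g 0 +_) (∑<-+ n _ _)) (+-assoc-comm (f 0) (g 0) _ _)
  where
  +-assoc-comm : ∀ a b c d → a + b + (c + d) ≡ a + c + (b + d)
  +-assoc-comm = solve-∀

∑<-* : ∀ n c f → ∑< n (λ k → c * f k) ≡ c * ∑< n f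
∑<-* zero c f = sym (*-zeroʳ c)
∑<-* (suc n) c f = trans (cong (c * f 0 +_) (∑<-* n c _)) (sym (*-distribˡ-+ c (f 0) _))

∑<-∣ : ∀ {d} n f → (∀ k → k < n → d ∣ f k) → d ∣ ∑< n f
∑<-∣ zero f _ = _ ∣0
∑<-∣ (suc n) f d∣f = ∣m∣n⇒∣m+n (d∣f 0 (s≤s z≤n)) (∑<-∣ n _ (λ k k<n → d∣f (suc k) (s≤s k<n)))

absorption : ∀ n k → suc k * (suc n C suc k) ≡ suc n * (n C k)
absorption zero zero = refl
absorption zero (suc k) = *-zeroʳ (suc (suc k))
absorption (suc n) zero = trans (*-identityˡ _) (trans (nC1≡n (suc (suc n))) (sym (*-identityʳ _)))
absorption (suc n) (suc k) = begin
    suc (suc k) * (suc (suc n) C suc (suc k))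
      ≡⟨ cong (suc (suc k) *_) (sym (nCk+nC[k+1]≡[n+1]C[k+1] (suc n) (suc k))) ⟩
    suc (suc k) * (c + c′)
      ≡⟨ spread c c′ k ⟩
    c + suc k * c + suc (suc k) * c′
      ≡⟨ cong₂ (λ x y → c + x + y) (absorption n k) (absorption n (suc k)) ⟩
    c + suc n * (n C k) + suc n * (n C suc k)
      ≡⟨ gather c (n C k) (n C suc k) n ⟩
    c + suc n * (n C k + n C suc k)
      ≡⟨ cong (λ x → c + suc n * x) (nCk+nC[k+1]≡[n+1]C[k+1] n k) ⟩
    suc (suc n) * c  ∎
  where
  open ≡-Reasoning
  c c′ : ℕ
  c = suc n C suc k
  c′ = suc n C suc (suc k)
  spread : ∀ a b k → suc (suc k) * (a + b) ≡ a + suc k * a + suc (suc k) * b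
  spread = solve-∀
  gather : ∀ a b c n → a + suc n * b + suc n * c ≡ a + suc n * (b + c)
  gather = solve-∀

-- A prime p divides C(p, k) for 0 < k < p: p divides k · C(p, k) = p · C(p-1, k-1)
-- but not k.
prime-∣-binomial : ∀ {n} → Prime (suc n) → ∀ k → k < n → suc n ∣ suc n C suc k
prime-∣-binomial {n} pp k k<n
  with euclidsLemma (suc k) (suc n C suc k) pp (subst (suc n ∣_) (sym (absorption n k)) (m∣m*n (n C k)))
... | inj₂ d = d
... | inj₁ d = ⊥-elim (<⇒≱ (s≤s k<n) (∣⇒≤ d))

binomialSum : ℕ → (ℕ → ℕ) → ℕ
binomialSum n g = ∑< (suc n) (λ k → (n C k) * g k)

binomialSum-suc : ∀ n g → binomialSum (suc n) g ≡ binomialSum n g + binomialSum n (λ k → g (suc k))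
binomialSum-suc n g = begin
    1 * g 0 + ∑< (suc n) (λ k → (suc n C suc k) * g (suc k))
      ≡⟨ cong (1 * g 0 +_) (∑<-cong (suc n) pascal) ⟩
    1 * g 0 + ∑< (suc n) (λ k → shifted k + tail k)
      ≡⟨ cong (1 * g 0 +_) (∑<-+ (suc n) shifted tail) ⟩
    1 * g 0 + (binomialSum n (λ k → g (suc k)) + ∑< (suc n) tail)
      ≡⟨ cong (λ x → 1 * g 0 + (binomialSum n (λ k → g (suc k)) + x)) last-vanishes ⟩
    1 * g 0 + (binomialSum n (λ k → g (suc k)) + ∑< n tail)
      ≡⟨ rotate (1 * g 0) _ _ ⟩
    binomialSum n g + binomialSum n (λ k → g (suc k))  ∎
  where
  open ≡-Reasoning
  shifted tail : ℕ → ℕ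
  shifted k = (n C k) * g (suc k)
  tail k = (n C suc k) * g (suc k)
  pascal : ∀ k → (suc n C suc k) * g (suc k) ≡ shifted k + tail k
  pascal k = trans (cong (_* g (suc k)) (sym (nCk+nC[k+1]≡[n+1]C[k+1] n k)))
                   (*-distribʳ-+ (g (suc k)) (n C k) (n C suc k))
  rotate : ∀ a b c → a + (b + c) ≡ a + c + b
  rotate = solve-∀
  last-vanishes : ∑< (suc n) tail ≡ ∑< n tail
  last-vanishes = begin
    ∑< (suc n) tail                        ≡⟨ ∑<-last n tail ⟩
    ∑< n tail + (n C suc n) * g (suc n)    ≡⟨ cong (λ x → ∑< n tail + x * g (suc n)) (k>n⇒nCk≡0 (n<1+n n)) ⟩
    ∑< n tail + 0                          ≡⟨ +-identityʳ _ ⟩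
    ∑< n tail                              ∎

binomialSum-* : ∀ n c g → binomialSum n (λ k → c * g k) ≡ c * binomialSum n g
binomialSum-* n c g = trans (∑<-cong (suc n) (λ k → x*[y*z]≡y*[x*z] (n C k) c (g k)))
                            (∑<-* (suc n) c (λ k → (n C k) * g k))
  where
  x*[y*z]≡y*[x*z] : ∀ x y z → x * (y * z) ≡ y * (x * z)
  x*[y*z]≡y*[x*z] = solve-∀

binomialSum-prime : ∀ {n} → Prime (suc n) → ∀ g
                  → ∃ λ M → suc n ∣ M × binomialSum (suc n) g ≡ g 0 + M + g (suc n)
binomialSum-prime {n} pp g = M , p∣M , (begin
    1 * g 0 + ∑< (suc n) (λ k → (suc n C suc k) * g (suc k))
      ≡⟨ cong₂ _+_ (*-identityˡ (g 0)) (∑<-last n _) ⟩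
    g 0 + (M + (suc n C suc n) * g (suc n))
      ≡⟨ cong (λ x → g 0 + (M + x * g (suc n))) (nCn≡1 (suc n)) ⟩
    g 0 + (M + 1 * g (suc n))
      ≡⟨ cong (λ x → g 0 + (M + x)) (*-identityˡ (g (suc n))) ⟩
    g 0 + (M + g (suc n))
      ≡⟨ sym (+-assoc (g 0) M _) ⟩
    g 0 + M + g (suc n)  ∎)
  where
  open ≡-Reasoning
  M : ℕ
  M = ∑< n (λ k → (suc n C suc k) * g (suc k))
  p∣M : suc n ∣ M
  p∣M = ∑<-∣ n _ (λ k k<n → ∣m⇒∣m*n (g (suc k)) (prime-∣-binomial pp k k<n))

-- √2^k = U k + V k √2.
rt2Pow : ℕ → ℕ × ℕ
rt2Pow zero = 1 , 0
rt2Pow (suc k) = 2 * proj₂ (rt2Pow k) , proj₁ (rt2Pow k)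

U V : ℕ → ℕ
U k = proj₁ (rt2Pow k)
V k = proj₂ (rt2Pow k)

U-odd : ∀ m → U (suc (m + m)) ≡ 0
U-odd m = cong (2 *_) (V-even m)
  where
  V-even : ∀ m → V (m + m) ≡ 0
  V-even zero = refl
  V-even (suc m) rewrite +-suc m m = cong (2 *_) (V-even m)

binomial-expansion : ∀ n → A n ≡ binomialSum n U × B n ≡ binomialSum n V
binomial-expansion zero = refl , refl
binomial-expansion (suc n) with binomial-expansion n
... | A≡ , B≡ =
    trans (cong₂ (λ x y → x + 2 * y) A≡ B≡)
          (sym (trans (binomialSum-suc n U) (cong (binomialSum n U +_) (binomialSum-* n 2 V))))
  , trans (cong₂ _+_ A≡ B≡)
          (sym (trans (binomialSum-suc n V) (+-comm (binomialSum n V) (binomialSum n U))))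

A-odd-prime : ∀ m → Prime (suc (m + m)) → ∃ λ M → suc (m + m) ∣ M × A (suc (m + m)) ≡ 1 + M
A-odd-prime m pp with binomialSum-prime pp U
... | M , p∣M , expansion = M , p∣M ,
  trans (proj₁ (binomial-expansion (suc (m + m))))
        (trans expansion (trans (cong (1 + M +_) (U-odd m)) (+-identityʳ (1 + M))))

-- An odd prime p divides P (p - 1) or P (p + 1): by Cassini and A p = 1 + M with p ∣ M,
-- 2 B (p-1) B (p+1) = A p ² - 1 = M (2 + M).
odd-prime-∣-neighbour : ∀ m → Prime (suc (m + m)) → ¬ (suc (m + m) ∣ 2)
                      → suc (m + m) ∣ B (m + m) ⊎ suc (m + m) ∣ B (suc (suc (m + m)))
odd-prime-∣-neighbour m pp p∤2 = neighbours (euclidsLemma 2 (B (m + m) * B (suc p)) pp p∣2BB)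
  where
  p M : ℕ
  p = suc (m + m)
  M = proj₁ (A-odd-prime m pp)
  p∣M : p ∣ M
  p∣M = proj₁ (proj₂ (A-odd-prime m pp))
  square : ∀ M → (1 + M) * (1 + M) ≡ 1 + M * (2 + M)
  square = solve-∀
  twice-product : 2 * (B (m + m) * B (suc p)) ≡ M * (2 + M)
  twice-product = suc-injective (begin
    1 + 2 * (B (m + m) * B (suc p))  ≡⟨ cassini-odd m ⟨
    A p * A p                        ≡⟨ cong (λ x → x * x) (proj₂ (proj₂ (A-odd-prime m pp))) ⟩
    (1 + M) * (1 + M)                ≡⟨ square M ⟩
    1 + M * (2 + M)                  ∎)
    where open ≡-Reasoning
  p∣2BB : p ∣ 2 * (B (m + m) * B (suc p))
  p∣2BB = subst (p ∣_) (sym twice-product) (∣m⇒∣m*n (2 + M) p∣M)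
  neighbours : p ∣ 2 ⊎ p ∣ B (m + m) * B (suc p) → p ∣ B (m + m) ⊎ p ∣ B (suc p)
  neighbours (inj₁ p∣2) = ⊥-elim (p∤2 p∣2)
  neighbours (inj₂ p∣BB) = euclidsLemma (B (m + m)) (B (suc p)) pp p∣BB

even-or-odd : ∀ n → ∃ λ k → n ≡ k + k ⊎ n ≡ suc (k + k)
even-or-odd zero = 0 , inj₁ refl
even-or-odd (suc n) with even-or-odd n
... | k , inj₁ n≡k+k = k , inj₂ (cong suc n≡k+k)
... | k , inj₂ n≡1+k+k = suc k , inj₁ (cong suc (trans n≡1+k+k (sym (+-suc k k))))

odd≢even : ∀ a b → suc (a + a) ≢ b + b
odd≢even zero zero ()
odd≢even zero (suc b) eq = 0≢1+n (trans (suc-injective eq) (+-suc b b))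
odd≢even (suc a) zero ()
odd≢even (suc a) (suc b) eq =
  odd≢even a b (suc-injective (trans (cong suc (sym (+-suc a a))) (trans (suc-injective eq) (+-suc b b))))

odd-∣-double : ∀ k t → suc (k + k) ∣ t + t → suc (k + k) ∣ t
odd-∣-double k t (divides q t+t≡qz) with even-or-odd q
... | j , inj₁ refl = divides j (halve (trans t+t≡qz (*-distribʳ-+ (suc (k + k)) j j)))
  where
  halve : ∀ {a b} → a + a ≡ b + b → a ≡ b
  halve {a} {b} eq = *-cancelˡ-≡ a b 2 (trans (double a) (trans eq (sym (double b))))
    where
    double : ∀ x → 2 * x ≡ x + x
    double = solve-∀
... | j , inj₂ refl = ⊥-elim (odd≢even (j + k + 2 * (j * k)) t (sym (trans t+t≡qz (odd-product j k))))
  where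
  odd-product : ∀ j k → suc (j + j) * suc (k + k) ≡ suc ((j + k + 2 * (j * k)) + (j + k + 2 * (j * k)))
  odd-product = solve-∀

prime-power-∣-cofactor : ∀ {p x} → Prime p → ¬ (p ∣ x) → ∀ e y → p ^ e ∣ x * y → p ^ e ∣ y
prime-power-∣-cofactor pp p∤x zero y _ = 1∣ y
prime-power-∣-cofactor {p} {x} pp p∤x (suc e) y p^e+1∣xy
  with euclidsLemma x y pp (∣-trans (m∣m*n (p ^ e)) p^e+1∣xy)
... | inj₁ p∣x = ⊥-elim (p∤x p∣x)
... | inj₂ (divides y′ refl) = subst (p * p ^ e ∣_) (*-comm p y′) (*-monoʳ-∣ p p^e∣y′)
  where
  rearrange : ∀ x y p → x * (y * p) ≡ p * (x * y)
  rearrange = solve-∀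
  p^e∣y′ : p ^ e ∣ y′
  p^e∣y′ = prime-power-∣-cofactor pp p∤x e y′
    (*-cancelˡ-∣ p {{prime⇒nonZero pp}} (subst (p * p ^ e ∣_) (rearrange x y′ p) p^e+1∣xy))

-- Let p ∤ 2 be prime with rank z, p^e ∣ P z, and let z divide
-- an even number 0 < 2t ≤ p + 1.
--   z = 2k:  P z = 2 B k · A k with p ∤ 2 B k (as k < z), so p^e ∣ A k and
--            p^(2e) ≤ A k ² ≤ A z ≤ A (p + 1);
--   z odd:   z ∣ t, so 2z ≤ p + 1 and p^(2e) ≤ B z ² ≤ A (2z) ≤ A (p + 1).
bound-via-even-multiple : ∀ {p z e} t → Prime p → ¬ (p ∣ 2) → IsRankOfApparition p z → p ^ e ∣ P z
                        → z ∣ t + t → 0 < t → t + t ≤ suc p → p ^ e * p ^ e ≤ A (suc p)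
bound-via-even-multiple {p} {z} {e} t pp p∤2 (z>0 , _ , minimal) p^e∣Pz z∣2t t>0 2t≤p+1
  with even-or-odd z
... | k , inj₁ refl = begin
    p ^ e * p ^ e  ≤⟨ *-mono-≤ p^e≤Ak p^e≤Ak ⟩
    A k * A k      ≤⟨ A²≤A-double k ⟩
    A (k + k)      ≤⟨ A-mono (≤-trans (∣⇒≤ {{>-nonZero 2t>0}} z∣2t) 2t≤p+1) ⟩
    A (suc p)      ∎
  where
  open ≤-Reasoning
  2t>0 : 0 < t + t
  2t>0 = ≤-trans t>0 (m≤m+n t t)
  half-pos : ∀ k → 0 < k + k → 0 < k
  half-pos (suc _) _ = s≤s z≤n
  k>0 : 0 < k
  k>0 = half-pos k z>0
  Bz≡2Bk*Ak : B (k + k) ≡ (2 * B k) * A k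
  Bz≡2Bk*Ak = trans (B-add k k) (collect (A k) (B k))
    where
    collect : ∀ a b → a * b + b * a ≡ (2 * b) * a
    collect = solve-∀
  p∤2Bk : ¬ (p ∣ 2 * B k)
  p∤2Bk p∣2Bk with euclidsLemma 2 (B k) pp p∣2Bk
  ... | inj₁ p∣2 = p∤2 p∣2
  ... | inj₂ p∣Bk = minimal k k>0 (m<m+n k k>0) (subst (p ∣_) (B≡P k) p∣Bk)
  p^e≤Ak : p ^ e ≤ A k
  p^e≤Ak = ∣⇒≤ {{>-nonZero (A-pos k)}} (prime-power-∣-cofactor pp p∤2Bk e (A k)
    (subst (p ^ e ∣_) (trans (sym (B≡P (k + k))) Bz≡2Bk*Ak) p^e∣Pz))
... | k , inj₂ refl = begin
    p ^ e * p ^ e  ≤⟨ *-mono-≤ p^e≤Bz p^e≤Bz ⟩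
    B z * B z      ≤⟨ B²≤A-double z ⟩
    A (z + z)      ≤⟨ A-mono (≤-trans (+-mono-≤ z≤t z≤t) 2t≤p+1) ⟩
    A (suc p)      ∎
  where
  open ≤-Reasoning
  z≤t : z ≤ t
  z≤t = ∣⇒≤ {{>-nonZero t>0}} (odd-∣-double k t z∣2t)
  p^e≤Bz : p ^ e ≤ B z
  p^e≤Bz = ∣⇒≤ {{>-nonZero (B-pos (k + k))}} (subst (p ^ e ∣_) (sym (B≡P z)) p^e∣Pz)

-- The bound for an odd prime p = 2m + 1: its rank divides p - 1 = 2m or p + 1 = 2(m + 1).
odd-prime-bound : ∀ m {z e} → 0 < m → Prime (suc (m + m)) → IsRankOfApparition (suc (m + m)) z
                → suc (m + m) ^ e ∣ P z → suc (m + m) ^ e * suc (m + m) ^ e ≤ A (suc (suc (m + m)))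
odd-prime-bound m {z} {e} m>0 pp rk p^e∣Pz = via-neighbour (odd-prime-∣-neighbour m pp p∤2)
  where
  p : ℕ
  p = suc (m + m)
  p∤2 : ¬ (p ∣ 2)
  p∤2 p∣2 = <⇒≱ (s≤s (+-mono-≤ m>0 m>0)) (∣⇒≤ p∣2)
  2[m+1]≡p+1 : suc m + suc m ≡ suc p
  2[m+1]≡p+1 = cong suc (+-suc m m)
  via-neighbour : p ∣ B (m + m) ⊎ p ∣ B (suc p) → p ^ e * p ^ e ≤ A (suc p)
  via-neighbour (inj₁ p∣Bp-1) = bound-via-even-multiple {e = e} m pp p∤2 rk p^e∣Pz
    (rank-divides (m + m) pp rk (subst (p ∣_) (B≡P (m + m)) p∣Bp-1)) m>0 (m≤n⇒m≤1+n (n≤1+n (m + m)))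
  via-neighbour (inj₂ p∣Bp+1) = bound-via-even-multiple {e = e} (suc m) pp p∤2 rk p^e∣Pz
    (rank-divides (suc m + suc m) pp rk
      (subst (p ∣_) (trans (B≡P (suc p)) (cong P (sym 2[m+1]≡p+1))) p∣Bp+1))
    (s≤s z≤n) (≤-reflexive 2[m+1]≡p+1)

-- For p = 2: 2 ∣ P 2 = 2 forces z ≤ 2, so 2^e ∣ P z ≤ 2 and 2^(2e) ≤ 4 ≤ A 3 = 7.
two-bound : ∀ {z e} → IsRankOfApparition 2 z → 2 ^ e ∣ P z → 2 ^ e * 2 ^ e ≤ A 3
two-bound {z} {e} rk 2^e∣Pz = ≤-trans (*-mono-≤ (2^e≤2 z rk 2^e∣Pz) (2^e≤2 z rk 2^e∣Pz)) (m≤m+n 4 3)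
  where
  2^e≤2 : ∀ z → IsRankOfApparition 2 z → 2 ^ e ∣ P z → 2 ^ e ≤ 2
  2^e≤2 zero (() , _) _
  2^e≤2 1 _ 2^e∣1 = ≤-trans (∣⇒≤ 2^e∣1) (s≤s z≤n)
  2^e≤2 2 _ 2^e∣2 = ∣⇒≤ 2^e∣2
  2^e≤2 (suc (suc (suc _))) (_ , _ , minimal) _ =
    ⊥-elim (minimal 2 (s≤s z≤n) (s≤s (s≤s (s≤s z≤n))) (divides 1 refl))

main-bound : ∀ p z e → Prime p → IsRankOfApparition p z → p ^ e ∣ P z → p ^ e * p ^ e ≤ A (suc p)
main-bound p z e pp rk p^e∣Pz with even-or-odd p
... | k , inj₁ p≡k+k with prime⇒irreducible pp (subst (2 ∣_) (sym (trans p≡k+k k+k≡2*k)) (m∣m*n k))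
  where
  k+k≡2*k : k + k ≡ 2 * k
  k+k≡2*k = cong (k +_) (sym (+-identityʳ k))
...   | inj₁ ()
...   | inj₂ refl = two-bound {e = e} rk p^e∣Pz
main-bound p z e pp rk p^e∣Pz | zero , inj₂ p≡1 =
  ⊥-elim (nonTrivial⇒≢1 {{prime⇒nonTrivial pp}} p≡1)
main-bound p z e pp rk p^e∣Pz | suc m , inj₂ refl =
  odd-prime-bound (suc m) {e = e} (s≤s z≤n) pp rk p^e∣Pz

below-α-power : ∀ {x} n → x ≤ A n → x ≤α^ n
below-α-power n x≤An rewrite m≤n⇒m∸n≡0 x≤An = z≤n

lemma10 : ∀ (p z e : ℕ) → Prime p → IsRankOfApparition p z → IsExactExponent p e (P z)
          → (p ^ (2 * e)) ≤α^ (p + 1)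
lemma10 p z e pp rk (p^e∣Pz , _) = below-α-power (p + 1)
  (subst₂ (λ x n → x ≤ A n) (sym p^2e≡p^e*p^e) (+-comm 1 p) (main-bound p z e pp rk p^e∣Pz))
  where
  p^2e≡p^e*p^e : p ^ (2 * e) ≡ p ^ e * p ^ e
  p^2e≡p^e*p^e = trans (cong (p ^_) (cong (e +_) (+-identityʳ e))) (^-distribˡ-+-* p e e)
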